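{- With the notation in the context, the following equalities of $\mathbb{Q}$-subspaces of $\mathbb{Q}[[z]]$ hold: (i) $\mathcal{MPL}^{\mathrm{adm}}_{>0}=\mathcal{MPL}^{\mathrm{adm}}$; (ii) $\mathcal{MPL}_{>0}=\mathcal{MPL}^{\mathrm{reg}}$.
   Context: An integer index is a tuple $\mathbf{k}=(k_1,\dots,k_r)\in\mathbb{Z}^r$ with $r\ge 0$ (for $r=0$ it is the empty index $\emptyset$). Let $\mathcal{I}=\bigsqcup_{r\ge0}\mathbb{Z}^r$ and $\mathcal{I}_{>0}=\bigsqcup_{r\ge0}\mathbb{Z}_{>0}^r$. For $\mathbf{k}=(k_1,\dots,k_r)$ with $r\ge1$ define the regularizability index $m_{\mathbf{k}}=\min_{1\le t\le r}\sum_{i=t}^{r}(k_i-1)$, and $m_\emptyset=\infty$. An integer index $\mathbf{k}$ is admissible if $m_{\mathbf{k}}>0$ and regularizable if $m_{\mathbf{k}}\ge 0$. Put $\mathcal{I}^{\mathrm{adm}}=\{\mathbf{k}\in\mathcal{I}: m_{\mathbf{k}}>0\}$, $\mathcal{I}^{\mathrm{reg}}=\{\mathbf{k}\in\mathcal{I}: m_{\mathbf{k}}\ge0\}$, $\mathcal{I}^{\mathrm{adm}}_{>0}=\mathcal{I}^{\mathrm{adm}}\cap\mathcal{I}_{>0}$ (note every positive index is regularizable). For an integer index $\mathbf{k}=(k_1,\dots,k_r)$, $r\ge1$, the multiple polylogarithm is the formal power series $\mathrm{Li}_{\mathbf{k}}(z)=\sum_{0<n_1<\cdots<n_r}\frac{z^{n_r}}{n_1^{k_1}\cdots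 n_r^{k_r}}\in\mathbb{Q}[[z]]$, and $\mathrm{Li}_\emptyset(z)=1$. Define the $\mathbb{Q}$-linear spans $\mathcal{MPL}^{\mathrm{adm}}_{>0}=\mathrm{span}_{\mathbb{Q}}\{\mathrm{Li}_{\mathbf{k}}:\mathbf{k}\in\mathcal{I}^{\mathrm{adm}}_{>0}\}$, $\mathcal{MPL}_{>0}=\mathrm{span}_{\mathbb{Q}}\{\mathrm{Li}_{\mathbf{k}}:\mathbf{k}\in\mathcal{I}_{>0}\}$, $\mathcal{MPL}^{\mathrm{adm}}=\mathrm{span}_{\mathbb{Q}}\{\mathrm{Li}_{\mathbf{k}}:\mathbf{k}\in\mathcal{I}^{\mathrm{adm}}\}$, $\mathcal{MPL}^{\mathrm{reg}}=\mathrm{span}_{\mathbb{Q}}\{\mathrm{Li}_{\mathbf{k}}:\mathbf{k}\in\mathcal{I}^{\mathrm{reg}}\}$, all inside $\mathbb{Q}[[z]]$. -}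

module Defs where

open import Data.Nat as ℕ using (ℕ; zero; suc)
open import Data.Integer as ℤ using (ℤ; +_; -[1+_]; _⊓_)
open import Data.Rational as ℚ using (ℚ; 0ℚ; 1ℚ)
open import Data.List using (List; []; _∷_; map; foldr; reverse)
open import Data.List.Relation.Unary.All using (All)
open import Data.Maybe using (Maybe; nothing; just)
open import Data.Product using (Σ; _×_; _,_; proj₂)
open import Data.Unit using (⊤)
open import Relation.Binary.PropositionalEquality using (_≡_)

Index : Set
Index = List ℤ

Series : Set
Series = ℕ → ℚ

defect : Index → ℤ
defect ks = foldr ℤ._+_ (+ 0) (map (λ x → x ℤ.- + 1) ks)

-- regularizability index m_k; nothing stands for m_∅ = ∞.
-- m_(k₁,…,k_r) = min_{1≤t≤r} Σ_{i=t}^{r} (k_i - 1)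
mIdx : Index → Maybe ℤ
mIdx [] = nothing
mIdx (k ∷ ks) with mIdx ks
... | nothing = just (defect (k ∷ ks))
... | just r  = just (defect (k ∷ ks) ⊓ r)

Admissible : Index → Set
Admissible k with mIdx k
... | nothing = ⊤
... | just m  = + 0 ℤ.< m

Regularizable : Index → Set
Regularizable k with mIdx k
... | nothing = ⊤
... | just m  = + 0 ℤ.≤ m

Positive : Index → Set
Positive k = All (λ x → + 0 ℤ.< x) k

AdmissiblePositive : Index → Set
AdmissiblePositive k = Admissible k × Positive k

_^ℚ_ : ℚ → ℕ → ℚ
q ^ℚ zero = 1ℚ
q ^ℚ suc e = q ℚ.* (q ^ℚ e)

-- n^{-k} for n : ℕ, k : ℤ (value at n = 0 is irrelevant, set to 0)
invPow : ℕ → ℤ → ℚ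
invPow zero _ = 0ℚ
invPow (suc m) (+ e) = ((+ 1) ℚ./ (suc m)) ^ℚ e
invPow (suc m) -[1+ e ] = ((+ suc m) ℚ./ 1) ^ℚ (suc e)

sumBelow : (ℕ → ℚ) → ℕ → ℚ
sumBelow f zero = 0ℚ
sumBelow f (suc N) = sumBelow f N ℚ.+ f N

-- Coefficient of z^N in Σ_{0<n₁<⋯<n_r} z^{n_r} / (n₁^{k₁}⋯n_r^{k_r}),
-- where the index is given in reversed order (k_r, …, k₁).
-- The empty index gives the series 1.
coeffRev : Index → ℕ → ℚ
coeffRev [] zero = 1ℚ
coeffRev [] (suc _) = 0ℚ
coeffRev (k ∷ ks) N = invPow N k ℚ.* sumBelow (coeffRev ks) N

Li : Index → Series
Li k = coeffRev (reverse k)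

linComb : List (ℚ × Index) → Series
linComb [] N = 0ℚ
linComb ((c , k) ∷ l) N = c ℚ.* Li k N ℚ.+ linComb l N

InSpanLi : (Index → Set) → Series → Set
InSpanLi P f = Σ (List (ℚ × Index)) λ l →
  All (λ ck → P (proj₂ ck)) l × (∀ N → f N ≡ linComb l N)

{-# OPTIONS --safe #-}
-- A nonpositive entry −a immediately followed by an entry v can be
-- eliminated. If c are the coefficients of Li_k′ and S(M) = Σ_{L<M} c(L), the
-- coefficients of Li_(k′,−a,v) are N^(−v) Σ_{M<N} M^a S(M). Summation by parts
-- against a Faulhaber polynomial F, F(M+1) − F(M) = M^a, rewrites this as
-- N^(−v) (F(N) S(N) − Σ_{L<N} F(L+1) c(L)); expanding F(N) and F(L+1) = F(L) + L^a
-- into powers N^j, j ≤ a+1, and using N^j N^(−x) = N^(−(x−j)) turns Li_(k′,−a,v)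
-- into a ℚ-combination of the shorter Li_(k′,v−j) and Li_(k″,y−j,v), k′ = (k″,y):
-- −a is absorbed into a neighbour, lowered by at most a+1. This never decreases a
-- suffix sum Σ_{i≥t} (k_i − 1), hence never decreases m_k. As m_k ≥ 0 forces k_r ≥ 1,
-- the rightmost nonpositive entry always has a right neighbour, and induction on the
-- length ends with positive indices k with m_k at least the original one.

module Submission where

open import Defs
open import Data.Product using (_×_)
open import Function.Bundles using (_⇔_)

open import Level using (0ℓ)
open import Data.Nat as ℕ using (ℕ; zero; suc; _≤_; _<_; s≤s)
import Data.Nat.Properties as ℕP
open import Data.Nat.Induction using (<-wellFounded)
import Data.Nat.Coprimality as Coprimality
open import Data.Integer as ℤ using (ℤ; +_; -[1+_]; +≤+; +<+)
import Data.Integer.Properties as ℤP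
open import Data.Integer.Tactic.RingSolver using () renaming (ring to ℤ-ring)
open import Data.Rational as ℚ using (ℚ; 0ℚ; 1ℚ; mkℚ; _+_; _*_; _-_; -_; _/_)
import Data.Rational.Properties as ℚP
open import Data.Vec as Vec using (Vec; []; _∷_; _∷ʳ_; zipWith; replicate)
open import Data.List as List using (List; []; _∷_; _++_; length; reverse; reverseAcc)
import Data.List.Properties as ListP
open import Data.List.Relation.Unary.All as All using (All; []; _∷_)
import Data.List.Relation.Unary.All.Properties as AllP
import Data.List.Relation.Unary.Any.Properties as AnyP
open import Data.Maybe using (Maybe; just; nothing)
open import Data.Product using (Σ; _,_; proj₁; proj₂; map₁; uncurry)
open import Data.Sum as Sum using (_⊎_; inj₁; inj₂)
open import Data.Unit using (⊤; tt)
open import Function using (_∘_)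
open import Function.Bundles using (mk⇔; module Equivalence)
open import Function.Construct.Composition using (_⇔-∘_)
open import Function.Construct.Identity using (⇔-id)
open import Function.Construct.Symmetry using (⇔-sym)
open import Induction.WellFounded using (Acc; acc)
open import Relation.Binary.PropositionalEquality
open import Relation.Nullary.Decidable using (dec⇒maybe)
open import Tactic.RingSolver using (solve-∀)
open import Tactic.RingSolver.Core.AlmostCommutativeRing using (AlmostCommutativeRing; fromCommutativeRing)

open ≡-Reasoning

private
  variable
    B B′ : Index → Series
    P Q : Index → Set
    f g : Series
    r s : Index

ℚ-ring : AlmostCommutativeRing 0ℓ 0ℓ
ℚ-ring = fromCommutativeRing ℚP.+-*-commutativeRing (λ q → dec⇒maybe (0ℚ ℚP.≟ q))

fromℕ : ℕ → ℚ
fromℕ n = + n / 1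

fromℕ≡mkℚ : ∀ n → fromℕ n ≡ mkℚ (+ n) 0 (Coprimality.sym (Coprimality.1-coprimeTo n))
fromℕ≡mkℚ n = ℚP.normalize-coprime (Coprimality.sym (Coprimality.1-coprimeTo n))

fromℕ-suc : ∀ n → fromℕ (suc n) ≡ 1ℚ + fromℕ n
fromℕ-suc n = begin
  fromℕ (suc n)
    -- ℚ addition computes on the normal form mkℚ (+ n) 0 _ of fromℕ n
    ≡⟨ cong (λ i → (+ 1 ℤ.+ i) / 1) (sym (ℤP.*-identityʳ (+ n))) ⟩
  1ℚ + mkℚ (+ n) 0 (Coprimality.sym (Coprimality.1-coprimeTo n))
    ≡⟨ cong (λ q → 1ℚ + q) (sym (fromℕ≡mkℚ n)) ⟩
  1ℚ + fromℕ n ∎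

1/[1+m]*[1+m]≡1 : ∀ m → (+ 1 / suc m) * fromℕ (suc m) ≡ 1ℚ
1/[1+m]*[1+m]≡1 m = begin
  (+ 1 / suc m) * fromℕ (suc m)
    ≡⟨ cong₂ _*_ (ℚP.normalize-coprime (Coprimality.1-coprimeTo (suc m))) (fromℕ≡mkℚ (suc m)) ⟩
  ℚ.1/ n * n
    ≡⟨ ℚP.*-inverseˡ n ⟩
  1ℚ ∎
  where n = mkℚ (+ suc m) 0 (Coprimality.sym (Coprimality.1-coprimeTo (suc m)))

invPow-pred : ∀ N x → invPow N (ℤ.pred x) ≡ fromℕ N * invPow N x
invPow-pred zero x = sym (ℚP.*-zeroʳ (fromℕ 0))
invPow-pred (suc m) (+ zero) = refl
invPow-pred (suc m) (+ suc e) = begin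
  i ^ℚ e                       ≡⟨ sym (ℚP.*-identityˡ (i ^ℚ e)) ⟩
  1ℚ * i ^ℚ e                  ≡⟨ cong (_* i ^ℚ e) (trans (sym (1/[1+m]*[1+m]≡1 m)) (ℚP.*-comm i n)) ⟩
  (n * i) * i ^ℚ e             ≡⟨ ℚP.*-assoc n i (i ^ℚ e) ⟩
  n * (i * i ^ℚ e)             ∎
  where
  i = + 1 / suc m
  n = fromℕ (suc m)
invPow-pred (suc m) -[1+ e ] = refl

invPow-sub : ∀ N x n → invPow N (x ℤ.- + n) ≡ fromℕ N ^ℚ n * invPow N x
invPow-sub N x zero = trans (cong (invPow N) (ℤP.+-identityʳ x)) (sym (ℚP.*-identityˡ (invPow N x)))
invPow-sub N x (suc n) = begin
  invPow N (x ℤ.- + suc n)             ≡⟨ cong (invPow N) (one-more x (+ n)) ⟩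
  invPow N (ℤ.pred (x ℤ.- + n))        ≡⟨ invPow-pred N (x ℤ.- + n) ⟩
  fromℕ N * invPow N (x ℤ.- + n)       ≡⟨ cong (fromℕ N *_) (invPow-sub N x n) ⟩
  fromℕ N * (fromℕ N ^ℚ n * invPow N x) ≡⟨ sym (ℚP.*-assoc (fromℕ N) (fromℕ N ^ℚ n) (invPow N x)) ⟩
  fromℕ N ^ℚ suc n * invPow N x        ∎
  where
  one-more : ∀ x n → x ℤ.- (+ 1 ℤ.+ n) ≡ -[1+ 0 ] ℤ.+ (x ℤ.- n)
  one-more = solve-∀ ℤ-ring

invPow-neg : ∀ m a → invPow (suc m) (ℤ.- + a) ≡ fromℕ (suc m) ^ℚ a
invPow-neg m zero = refl
invPow-neg m (suc a) = refl

-- Polynomials and Faulhaber's formula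

eval : ∀ {n} → Vec ℚ n → ℚ → ℚ
eval [] x = 0ℚ
eval (_∷_ {n} c p) x = c * x ^ℚ n + eval p x

eval-zipWith-+ : ∀ {n} (p q : Vec ℚ n) x → eval (zipWith _+_ p q) x ≡ eval p x + eval q x
eval-zipWith-+ [] [] x = sym (ℚP.+-identityʳ 0ℚ)
eval-zipWith-+ (_∷_ {n} a p) (b ∷ q) x =
  trans (cong (λ e → (a + b) * x ^ℚ n + e) (eval-zipWith-+ p q x)) (regroup a b (x ^ℚ n) (eval p x) (eval q x))
  where
  regroup : ∀ a b y u v → (a + b) * y + (u + v) ≡ (a * y + u) + (b * y + v)
  regroup = solve-∀ ℚ-ring

eval-map-* : ∀ {n} c (p : Vec ℚ n) x → eval (Vec.map (c *_) p) x ≡ c * eval p x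
eval-map-* c [] x = sym (ℚP.*-zeroʳ c)
eval-map-* c (_∷_ {n} a p) x =
  trans (cong (λ e → c * a * x ^ℚ n + e) (eval-map-* c p x)) (regroup c a (x ^ℚ n) (eval p x))
  where
  regroup : ∀ c a y u → c * a * y + c * u ≡ c * (a * y + u)
  regroup = solve-∀ ℚ-ring

eval-∷ʳ-0 : ∀ {n} (p : Vec ℚ n) x → eval (p ∷ʳ 0ℚ) x ≡ x * eval p x
eval-∷ʳ-0 [] x = sym (ℚP.*-zeroʳ x)
eval-∷ʳ-0 (_∷_ {n} a p) x =
  trans (cong (λ e → a * x ^ℚ suc n + e) (eval-∷ʳ-0 p x)) (regroup a x (x ^ℚ n) (eval p x))
  where
  regroup : ∀ a x y u → a * (x * y) + x * u ≡ x * (a * y + u)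
  regroup = solve-∀ ℚ-ring

eval-replicate-0 : ∀ n x → eval (replicate n 0ℚ) x ≡ 0ℚ
eval-replicate-0 zero x = refl
eval-replicate-0 (suc n) x = trans (cong (λ e → 0ℚ * x ^ℚ n + e) (eval-replicate-0 n x)) (vanish (x ^ℚ n))
  where
  vanish : ∀ y → 0ℚ * y + 0ℚ ≡ 0ℚ
  vanish = solve-∀ ℚ-ring

binomial-tail : ∀ m → Vec ℚ m
binomial-tail zero = []
binomial-tail (suc m) = zipWith _+_ (binomial-tail m ∷ʳ 0ℚ) (fromℕ (suc m) ∷ binomial-tail m)

binomial-expansion : ∀ m x →
  (1ℚ + x) ^ℚ suc m ≡ x ^ℚ suc m + fromℕ (suc m) * x ^ℚ m + eval (binomial-tail m) x
binomial-expansion zero x = expand x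
  where
  expand : ∀ x → (1ℚ + x) * 1ℚ ≡ x * 1ℚ + 1ℚ * 1ℚ + 0ℚ
  expand = solve-∀ ℚ-ring
binomial-expansion (suc m) x = begin
  (1ℚ + x) * (1ℚ + x) ^ℚ suc m
    ≡⟨ cong ((1ℚ + x) *_) (binomial-expansion m x) ⟩
  (1ℚ + x) * (x * y + k * y + t)
    ≡⟨ expand x y k t ⟩
  x * (x * y) + (1ℚ + k) * (x * y) + (x * t + (k * y + t))
    ≡⟨ cong₂ (λ k′ t′ → x * (x * y) + k′ * (x * y) + t′)
             (sym (fromℕ-suc (suc m))) (sym tail≡) ⟩
  x ^ℚ suc (suc m) + fromℕ (suc (suc m)) * x ^ℚ suc m + eval (binomial-tail (suc m)) x ∎
  where
  y = x ^ℚ m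
  k = fromℕ (suc m)
  t = eval (binomial-tail m) x
  tail≡ : eval (binomial-tail (suc m)) x ≡ x * t + (k * y + t)
  tail≡ = trans (eval-zipWith-+ (binomial-tail m ∷ʳ 0ℚ) (k ∷ binomial-tail m) x)
                (cong (_+ (k * y + t)) (eval-∷ʳ-0 (binomial-tail m) x))
  expand : ∀ x y k t →
    (1ℚ + x) * (x * y + k * y + t) ≡ x * (x * y) + (1ℚ + k) * (x * y) + (x * t + (k * y + t))
  expand = solve-∀ ℚ-ring

-- The leading coefficient c/(m+1) is forced by (1+x)^(m+1) − x^(m+1) = (m+1) x^m + …;
-- the lower-order remainder is handled recursively.
antidifference : ∀ {n} → Vec ℚ n → Vec ℚ (suc n)
antidifference [] = 0ℚ ∷ []
antidifference (_∷_ {m} c p) = d ∷ antidifference (zipWith _+_ p (Vec.map (- d *_) (binomial-tail m)))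
  where d = c * (+ 1 / suc m)

antidifference-step : ∀ {n} (p : Vec ℚ n) x →
  eval (antidifference p) (1ℚ + x) ≡ eval (antidifference p) x + eval p x
antidifference-step [] x = refl
antidifference-step (_∷_ {m} c p) x = begin
  d * (1ℚ + x) ^ℚ suc m + eval F (1ℚ + x)
    ≡⟨ cong₂ (λ u v → d * u + v) (binomial-expansion m x) (antidifference-step q x) ⟩
  d * (x * y + k * y + t) + (eval F x + eval q x)
    ≡⟨ cong (λ v → d * (x * y + k * y + t) + (eval F x + v)) q≡ ⟩
  d * (x * y + k * y + t) + (eval F x + (eval p x + - d * t))
    ≡⟨ regroup d x y k t (eval F x) (eval p x) ⟩
  (d * (x * y) + eval F x) + (d * k * y + eval p x)
    ≡⟨ cong (λ e → (d * (x * y) + eval F x) + (e * y + eval p x)) d*k≡c ⟩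
  (d * x ^ℚ suc m + eval F x) + (c * y + eval p x) ∎
  where
  d = c * (+ 1 / suc m)
  k = fromℕ (suc m)
  y = x ^ℚ m
  t = eval (binomial-tail m) x
  q = zipWith _+_ p (Vec.map (- d *_) (binomial-tail m))
  F = antidifference q
  q≡ : eval q x ≡ eval p x + - d * t
  q≡ = trans (eval-zipWith-+ p _ x) (cong (λ e → eval p x + e) (eval-map-* (- d) (binomial-tail m) x))
  d*k≡c : d * k ≡ c
  d*k≡c = trans (ℚP.*-assoc c _ k) (trans (cong (c *_) (1/[1+m]*[1+m]≡1 m)) (ℚP.*-identityʳ c))
  regroup : ∀ d x y k t f e →
    d * (x * y + k * y + t) + (f + (e + - d * t)) ≡ (d * (x * y) + f) + (d * k * y + e)
  regroup = solve-∀ ℚ-ring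

faulhaber-poly : ∀ a → Vec ℚ (suc (suc a))
faulhaber-poly a = antidifference (1ℚ ∷ replicate a 0ℚ)

faulhaber : ℕ → ℕ → ℚ
faulhaber a N = eval (faulhaber-poly a) (fromℕ N)

faulhaber-step : ∀ a N → faulhaber a (suc N) ≡ faulhaber a N + fromℕ N ^ℚ a
faulhaber-step a N = begin
  eval F (fromℕ (suc N))
    ≡⟨ cong (eval F) (fromℕ-suc N) ⟩
  eval F (1ℚ + n)
    ≡⟨ antidifference-step (1ℚ ∷ replicate a 0ℚ) n ⟩
  eval F n + (1ℚ * n ^ℚ a + eval (replicate a 0ℚ) n)
    ≡⟨ cong (λ e → eval F n + (1ℚ * n ^ℚ a + e)) (eval-replicate-0 a n) ⟩
  eval F n + (1ℚ * n ^ℚ a + 0ℚ)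
    ≡⟨ cong (λ e → eval F n + e) (trans (ℚP.+-identityʳ _) (ℚP.*-identityˡ (n ^ℚ a))) ⟩
  eval F n + n ^ℚ a ∎
  where
  F = faulhaber-poly a
  n = fromℕ N

sumBelow-cong : (∀ M → f M ≡ g M) → ∀ N → sumBelow f N ≡ sumBelow g N
sumBelow-cong f≗g zero = refl
sumBelow-cong f≗g (suc N) = cong₂ _+_ (sumBelow-cong f≗g N) (f≗g N)

sumBelow-zero : ∀ N → sumBelow (λ _ → 0ℚ) N ≡ 0ℚ
sumBelow-zero zero = refl
sumBelow-zero (suc N) = cong (_+ 0ℚ) (sumBelow-zero N)

sumBelow-linear : ∀ c (f g : Series) N → sumBelow (λ M → c * f M + g M) N ≡ c * sumBelow f N + sumBelow g N
sumBelow-linear c f g zero = sym (trans (ℚP.+-identityʳ (c * 0ℚ)) (ℚP.*-zeroʳ c))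
sumBelow-linear c f g (suc N) =
  trans (cong (_+ (c * f N + g N)) (sumBelow-linear c f g N))
        (regroup c (sumBelow f N) (sumBelow g N) (f N) (g N))
  where
  regroup : ∀ c s t x y → (c * s + t) + (c * x + y) ≡ c * (s + x) + (t + y)
  regroup = solve-∀ ℚ-ring

sumBelow-by-parts : ∀ (F g c : Series) → (∀ M → F (suc M) ≡ F M + g M) → ∀ N →
  sumBelow (λ M → g M * sumBelow c M) N ≡ F N * sumBelow c N - sumBelow (λ L → F (suc L) * c L) N
sumBelow-by-parts F g c step zero = vanish (F 0)
  where
  vanish : ∀ y → 0ℚ ≡ y * 0ℚ - 0ℚ
  vanish = solve-∀ ℚ-ring
sumBelow-by-parts F g c step (suc N) = begin
  sumBelow (λ M → g M * sumBelow c M) N + g N * S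
    ≡⟨ cong (_+ g N * S) (sumBelow-by-parts F g c step N) ⟩
  (F N * S - T) + g N * S
    ≡⟨ regroup (F N) (g N) S (c N) T ⟩
  (F N + g N) * (S + c N) - (T + (F N + g N) * c N)
    ≡⟨ cong (λ y → y * (S + c N) - (T + y * c N)) (sym (step N)) ⟩
  F (suc N) * (S + c N) - (T + F (suc N) * c N) ∎
  where
  S = sumBelow c N
  T = sumBelow (λ L → F (suc L) * c L) N
  regroup : ∀ y z s c t → (y * s - t) + z * s ≡ (y + z) * (s + c) - (t + (y + z) * c)
  regroup = solve-∀ ℚ-ring

-- coeffRev (x ∷ r) N unfolds to prepend x (coeffRev r) N.
prepend : ℤ → Series → Series
prepend x f N = invPow N x * sumBelow f N

prepend-cong : ∀ x → (∀ M → f M ≡ g M) → ∀ N → prepend x f N ≡ prepend x g N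
prepend-cong x f≗g N = cong (invPow N x *_) (sumBelow-cong f≗g N)

prepend-zero : ∀ x N → prepend x (λ _ → 0ℚ) N ≡ 0ℚ
prepend-zero x N = trans (cong (invPow N x *_) (sumBelow-zero N)) (ℚP.*-zeroʳ (invPow N x))

prepend-linear : ∀ x c (f g : Series) N →
  prepend x (λ M → c * f M + g M) N ≡ c * prepend x f N + prepend x g N
prepend-linear x c f g N =
  trans (cong (invPow N x *_) (sumBelow-linear c f g N)) (regroup (invPow N x) c (sumBelow f N) (sumBelow g N))
  where
  regroup : ∀ i c s t → i * (c * s + t) ≡ c * (i * s) + i * t
  regroup = solve-∀ ℚ-ring

-- Linear spans

Combination : Set
Combination = List (ℚ × Index)

combine : (Index → ℚ) → Combination → ℚ
combine v [] = 0ℚ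
combine v ((c , k) ∷ l) = c * v k + combine v l

combine-++ : ∀ v l l′ → combine v (l ++ l′) ≡ combine v l + combine v l′
combine-++ v [] l′ = sym (ℚP.+-identityˡ (combine v l′))
combine-++ v ((c , k) ∷ l) l′ =
  trans (cong (λ e → c * v k + e) (combine-++ v l l′))
        (sym (ℚP.+-assoc (c * v k) (combine v l) (combine v l′)))

combine-scale : ∀ v c l → combine v (List.map (map₁ (c *_)) l) ≡ c * combine v l
combine-scale v c [] = sym (ℚP.*-zeroʳ c)
combine-scale v c ((a , k) ∷ l) =
  trans (cong (λ e → c * a * v k + e) (combine-scale v c l)) (regroup c a (v k) (combine v l))
  where
  regroup : ∀ c a y u → c * a * y + c * u ≡ c * (a * y + u)
  regroup = solve-∀ ℚ-ring

Span : (Index → Series) → (Index → Set) → Series → Set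
Span B P f = Σ Combination λ l → All (P ∘ proj₂) l × (∀ N → f N ≡ combine (λ k → B k N) l)

Span-cong : (∀ N → f N ≡ g N) → Span B P f → Span B P g
Span-cong f≗g (l , ps , e) = l , ps , λ N → trans (sym (f≗g N)) (e N)

Span-zero : Span B P (λ _ → 0ℚ)
Span-zero = [] , [] , λ _ → refl

Span-single : P r → Span B P (B r)
Span-single {r = r} {B = B} p = (1ℚ , r) ∷ [] , p ∷ [] , λ N → sym (unit (B r N))
  where
  unit : ∀ y → 1ℚ * y + 0ℚ ≡ y
  unit = solve-∀ ℚ-ring

Span-+ : Span B P f → Span B P g → Span B P (λ N → f N + g N)
Span-+ (l , ps , e) (l′ , ps′ , e′) =
  l ++ l′ , AllP.++⁺ ps ps′ , λ N → trans (cong₂ _+_ (e N) (e′ N)) (sym (combine-++ _ l l′))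

Span-scale : ∀ c → Span B P f → Span B P (λ N → c * f N)
Span-scale c (l , ps , e) =
  List.map (map₁ (c *_)) l , AllP.map⁺ ps , λ N → trans (cong (c *_) (e N)) (sym (combine-scale _ c l))

Span-- : Span B P f → Span B P g → Span B P (λ N → f N - g N)
Span-- {f = f} {g = g} sf sg = Span-cong (λ N → minus (f N) (g N)) (Span-+ sf (Span-scale (- 1ℚ) sg))
  where
  minus : ∀ y z → y + - 1ℚ * z ≡ y - z
  minus = solve-∀ ℚ-ring

Span-combine : ∀ l → All (λ t → Span B′ Q (B (proj₂ t))) l →
  Span B′ Q (λ N → combine (λ k → B k N) l)
Span-combine [] [] = Span-zero
Span-combine ((c , k) ∷ l) (s ∷ ss) = Span-+ (Span-scale c s) (Span-combine l ss)

Span-bind : Span B P f → (∀ {k} → P k → Span B′ Q (B k)) → Span B′ Q f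
Span-bind (l , ps , e) h = Span-cong (sym ∘ e) (Span-combine l (All.map h ps))

Span-weaken : (∀ {k} → P k → Q k) → Span B P f → Span B Q f
Span-weaken h s = Span-bind s (Span-single ∘ h)

Span-prepend : ∀ x → (∀ {k} → P k → Q (x ∷ k)) → Span coeffRev P f → Span coeffRev Q (prepend x f)
Span-prepend {P = P} {Q = Q} x h (l , ps , e) = Span-cong (λ N → sym (prepend-cong x e N)) (go l ps)
  where
  go : ∀ l → All (P ∘ proj₂) l → Span coeffRev Q (prepend x (λ N → combine (λ k → coeffRev k N) l))
  go [] [] = Span-cong (λ N → sym (prepend-zero x N)) Span-zero
  go ((c , k) ∷ l) (p ∷ ps) =
    Span-cong (λ N → sym (prepend-linear x c (coeffRev k) _ N))
      (Span-+ (Span-scale c (Span-single (h p))) (go l ps))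

-- Regularizability of reversed indices

infix 4 _≤ᵐ_ _≼_ _⊏_

-- For a reversed index r = (k_r, …, k_1), b ≤ᵐ r says that every suffix sum
-- Σ_{i≥t} (k_i − 1) of k is at least b, i.e. b ≤ m_k (see ≤ᵐ-reverse).
_≤ᵐ_ : ℤ → Index → Set
b ≤ᵐ [] = ⊤
b ≤ᵐ (x ∷ r) = b ℤ.≤ x ℤ.- + 1 × b ℤ.- (x ℤ.- + 1) ≤ᵐ r

≤ᵐ-antitone : ∀ {b b′} r → b′ ℤ.≤ b → b ≤ᵐ r → b′ ≤ᵐ r
≤ᵐ-antitone [] _ _ = tt
≤ᵐ-antitone (x ∷ r) b′≤b (h , hs) =
  ℤP.≤-trans b′≤b h , ≤ᵐ-antitone r (ℤP.+-monoˡ-≤ (ℤ.- (x ℤ.- + 1)) b′≤b) hs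

positive⇒≤ᵐ : ∀ {b} r → b ℤ.≤ + 0 → Positive r → b ≤ᵐ r
positive⇒≤ᵐ [] _ [] = tt
positive⇒≤ᵐ {b} (x ∷ r) b≤0 (x>0 ∷ ps) =
  ℤP.≤-trans b≤0 0≤x-1 ,
  positive⇒≤ᵐ r (ℤP.≤-trans (ℤP.+-monoʳ-≤ b (ℤP.neg-mono-≤ 0≤x-1))
                            (subst (ℤ._≤ + 0) (sym (ℤP.+-identityʳ b)) b≤0)) ps
  where
  0≤x-1 : + 0 ℤ.≤ x ℤ.- + 1
  0≤x-1 = ℤP.i≤j⇒0≤j-i (ℤP.i<j⇒suc[i]≤j x>0)

sub-≤⇔≤-+ : ∀ {i j k} → i ℤ.- j ℤ.≤ k ⇔ i ℤ.≤ k ℤ.+ j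
sub-≤⇔≤-+ {i} {j} {k} = mk⇔
  (subst (ℤ._≤ k ℤ.+ j) (cancel i j) ∘ ℤP.+-monoˡ-≤ j)
  (subst (i ℤ.- j ℤ.≤_) (cancel′ k j) ∘ ℤP.+-monoˡ-≤ (ℤ.- j))
  where
  cancel : ∀ i j → i ℤ.- j ℤ.+ j ≡ i
  cancel = solve-∀ ℤ-ring
  cancel′ : ∀ k j → k ℤ.+ j ℤ.- j ≡ k
  cancel′ = solve-∀ ℤ-ring

record _≼_ (s r : Index) : Set where
  constructor dominated
  field transfer : ∀ {b} → b ≤ᵐ r → b ≤ᵐ s
open _≼_

≼-refl : r ≼ r
≼-refl = dominated λ h → h

≼-trans : ∀ {t} → t ≼ s → s ≼ r → t ≼ r
≼-trans t≼s s≼r = dominated λ h → transfer t≼s (transfer s≼r h)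

≼-cons : ∀ {x} → s ≼ r → x ∷ s ≼ x ∷ r
≼-cons s≼r = dominated λ (h , hs) → h , transfer s≼r hs

≼-merge : ∀ x y z ks → (y ℤ.- + 1) ℤ.+ (x ℤ.- + 1) ℤ.≤ z ℤ.- + 1 → z ∷ ks ≼ x ∷ y ∷ ks
≼-merge x y z ks bound = dominated λ {b} (_ , hy , hs) →
  ℤP.≤-trans (Equivalence.to sub-≤⇔≤-+ hy) bound ,
  ≤ᵐ-antitone ks (subst (b ℤ.- (z ℤ.- + 1) ℤ.≤_) (split b (x ℤ.- + 1) (y ℤ.- + 1))
                         (ℤP.+-monoʳ-≤ b (ℤP.neg-mono-≤ bound))) hs
  where
  split : ∀ b dx dy → b ℤ.- (dy ℤ.+ dx) ≡ b ℤ.- dx ℤ.- dy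
  split = solve-∀ ℤ-ring

merge≤lower : ∀ x j a → j ≤ suc a →
  (x ℤ.- + 1) ℤ.+ (ℤ.- + a ℤ.- + 1) ℤ.≤ (x ℤ.- + j) ℤ.- + 1
merge≤lower x j a j≤1+a =
  subst₂ ℤ._≤_ (sym (e₁ x (+ a))) (e₂ x (+ j))
    (ℤP.+-monoʳ-≤ (x ℤ.- + 1) (ℤP.neg-mono-≤ (+≤+ j≤1+a)))
  where
  e₁ : ∀ x a → (x ℤ.- + 1) ℤ.+ (ℤ.- a ℤ.- + 1) ≡ (x ℤ.- + 1) ℤ.- (+ 1 ℤ.+ a)
  e₁ = solve-∀ ℤ-ring
  e₂ : ∀ x j → (x ℤ.- + 1) ℤ.- j ≡ (x ℤ.- j) ℤ.- + 1
  e₂ = solve-∀ ℤ-ring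

_⊏_ : Index → Index → Set
s ⊏ r = length s < length r × s ≼ r

⊏-cons : ∀ {x} → s ⊏ r → x ∷ s ⊏ x ∷ r
⊏-cons (s<r , s≼r) = s≤s s<r , ≼-cons s≼r

lower-⊏ : ∀ x j a ks → j ≤ suc a → (x ℤ.- + j) ∷ ks ⊏ x ∷ ℤ.- + a ∷ ks
lower-⊏ x j a ks j≤1+a =
  ℕP.n<1+n _ ,
  ≼-merge x (ℤ.- + a) (x ℤ.- + j) ks
    (subst (ℤ._≤ (x ℤ.- + j) ℤ.- + 1) (ℤP.+-comm (x ℤ.- + 1) _) (merge≤lower x j a j≤1+a))

lower-next-⊏ : ∀ x y j a ks → j ≤ suc a → x ∷ (y ℤ.- + j) ∷ ks ⊏ x ∷ ℤ.- + a ∷ y ∷ ks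
lower-next-⊏ x y j a ks j≤1+a =
  ⊏-cons (ℕP.n<1+n _ , ≼-merge (ℤ.- + a) y (y ℤ.- + j) ks (merge≤lower y j a j≤1+a))

truncate-⊏ : ∀ x y → x ∷ [] ⊏ x ∷ y ∷ []
truncate-⊏ x y = ℕP.n<1+n 1 , dominated λ (h , _) → h , tt

-- Eliminating a nonpositive entry

Span-eval-*-coeffRev : ∀ {n} (p : Vec ℚ n) x ks → (∀ {j} → j < n → P ((x ℤ.- + j) ∷ ks)) →
  Span coeffRev P (λ N → eval p (fromℕ N) * coeffRev (x ∷ ks) N)
Span-eval-*-coeffRev [] x ks _ = Span-cong (λ N → sym (ℚP.*-zeroˡ (coeffRev (x ∷ ks) N))) Span-zero
Span-eval-*-coeffRev (_∷_ {n} c p) x ks h =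
  Span-cong shift (Span-+ (Span-scale c (Span-single (h (ℕP.n<1+n n))))
                          (Span-eval-*-coeffRev p x ks (λ j<n → h (ℕP.m<n⇒m<1+n j<n))))
  where
  regroup : ∀ c y i s e → c * ((y * i) * s) + e * (i * s) ≡ (c * y + e) * (i * s)
  regroup = solve-∀ ℚ-ring
  shift : ∀ N → c * coeffRev ((x ℤ.- + n) ∷ ks) N + eval p (fromℕ N) * coeffRev (x ∷ ks) N
              ≡ eval (c ∷ p) (fromℕ N) * coeffRev (x ∷ ks) N
  shift N = trans (cong (λ i → c * (i * S) + eval p (fromℕ N) * (invPow N x * S)) (invPow-sub N x n))
                  (regroup c (fromℕ N ^ℚ n) (invPow N x) S (eval p (fromℕ N)))
    where S = sumBelow (coeffRev ks) N

coeffRev-by-parts : ∀ v a ks N →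
  coeffRev (v ∷ ℤ.- + a ∷ ks) N
    ≡ faulhaber a N * coeffRev (v ∷ ks) N - prepend v (λ L → faulhaber a (suc L) * coeffRev ks L) N
coeffRev-by-parts v a ks N = begin
  invPow N v * sumBelow (λ M → invPow M (ℤ.- + a) * S M) N
    ≡⟨ cong (invPow N v *_) (sumBelow-cong invPow-neg-S N) ⟩
  invPow N v * sumBelow (λ M → fromℕ M ^ℚ a * S M) N
    ≡⟨ cong (invPow N v *_) (sumBelow-by-parts (faulhaber a) _ (coeffRev ks) (faulhaber-step a) N) ⟩
  invPow N v * (faulhaber a N * S N - T)
    ≡⟨ regroup (invPow N v) (faulhaber a N) (S N) T ⟩
  faulhaber a N * (invPow N v * S N) - invPow N v * T ∎
  where
  S = sumBelow (coeffRev ks)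
  T = sumBelow (λ L → faulhaber a (suc L) * coeffRev ks L) N
  invPow-neg-S : ∀ M → invPow M (ℤ.- + a) * S M ≡ fromℕ M ^ℚ a * S M
  invPow-neg-S zero = trans (ℚP.*-zeroʳ 0ℚ) (sym (ℚP.*-zeroʳ (fromℕ 0 ^ℚ a)))
  invPow-neg-S (suc m) = cong (_* S (suc m)) (invPow-neg m a)
  regroup : ∀ i f s t → i * (f * s - t) ≡ f * (i * s) - i * t
  regroup = solve-∀ ℚ-ring

Span-faulhaber-suc-*-coeffRev : ∀ v a ks →
  Span coeffRev (λ s → v ∷ s ⊏ v ∷ ℤ.- + a ∷ ks) (λ L → faulhaber a (suc L) * coeffRev ks L)
Span-faulhaber-suc-*-coeffRev v a [] =
  Span-cong collapse (Span-scale (faulhaber a 1) (Span-single (truncate-⊏ v (ℤ.- + a))))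
  where
  collapse : ∀ L → faulhaber a 1 * coeffRev [] L ≡ faulhaber a (suc L) * coeffRev [] L
  collapse zero = refl
  collapse (suc L) = trans (ℚP.*-zeroʳ (faulhaber a 1)) (sym (ℚP.*-zeroʳ (faulhaber a (suc (suc L)))))
Span-faulhaber-suc-*-coeffRev v a (y ∷ ks) =
  Span-cong split
    (Span-+ (Span-eval-*-coeffRev (faulhaber-poly a) y ks
               (λ {j} j<2+a → lower-next-⊏ v y j a ks (ℕ.s≤s⁻¹ j<2+a)))
            (Span-single (lower-next-⊏ v y a a ks (ℕP.n≤1+n a))))
  where
  regroup : ∀ f y i s → f * (i * s) + (y * i) * s ≡ (f + y) * (i * s)
  regroup = solve-∀ ℚ-ring
  split : ∀ L → faulhaber a L * coeffRev (y ∷ ks) L + coeffRev ((y ℤ.- + a) ∷ ks) L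
              ≡ faulhaber a (suc L) * coeffRev (y ∷ ks) L
  split L = begin
    faulhaber a L * (invPow L y * S) + invPow L (y ℤ.- + a) * S
      ≡⟨ cong (λ i → faulhaber a L * (invPow L y * S) + i * S) (invPow-sub L y a) ⟩
    faulhaber a L * (invPow L y * S) + (fromℕ L ^ℚ a * invPow L y) * S
      ≡⟨ regroup (faulhaber a L) (fromℕ L ^ℚ a) (invPow L y) S ⟩
    (faulhaber a L + fromℕ L ^ℚ a) * (invPow L y * S)
      ≡⟨ cong (_* (invPow L y * S)) (sym (faulhaber-step a L)) ⟩
    faulhaber a (suc L) * (invPow L y * S) ∎
    where S = sumBelow (coeffRev ks) L

-- A nonpositive entry with a right neighbour in the unreversed index.
data Reducible : Index → Set where
  here  : ∀ v a ks → Reducible (v ∷ ℤ.- + a ∷ ks)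
  there : ∀ {x ks} → Reducible ks → Reducible (x ∷ ks)

positive-or-reducible : ∀ {x} ks → + 0 ℤ.< x → Positive (x ∷ ks) ⊎ Reducible (x ∷ ks)
positive-or-reducible [] x>0 = inj₁ (x>0 ∷ [])
positive-or-reducible (+ zero ∷ ks) _ = inj₂ (here _ 0 ks)
positive-or-reducible (-[1+ a ] ∷ ks) _ = inj₂ (here _ (suc a) ks)
positive-or-reducible (+ suc n ∷ ks) x>0 = Sum.map (x>0 ∷_) there (positive-or-reducible ks (+<+ ℕ.z<s))

reducible-span : Reducible r → Span coeffRev (_⊏ r) (coeffRev r)
reducible-span (here v a ks) =
  Span-cong (sym ∘ coeffRev-by-parts v a ks)
    (Span-- (Span-eval-*-coeffRev (faulhaber-poly a) v ks
               (λ {j} j<2+a → lower-⊏ v j a ks (ℕ.s≤s⁻¹ j<2+a)))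
            (Span-prepend v (λ h → h) (Span-faulhaber-suc-*-coeffRev v a ks)))
reducible-span (there {x} red) = Span-prepend x ⊏-cons (reducible-span red)

≤ᵐ-head-positive : ∀ {x} r → + 0 ≤ᵐ x ∷ r → + 0 ℤ.< x
≤ᵐ-head-positive _ (h , _) = ℤP.suc[i]≤j⇒i<j (ℤP.0≤i-j⇒j≤i h)

positive-span : ∀ r → Acc _<_ (length r) → + 0 ≤ᵐ r →
  Span coeffRev (λ s → s ≼ r × Positive s) (coeffRev r)
positive-span [] _ _ = Span-single (≼-refl , [])
positive-span (x ∷ ks) (acc rec) h with positive-or-reducible ks (≤ᵐ-head-positive ks h)
... | inj₁ pos = Span-single (≼-refl , pos)
... | inj₂ red = Span-bind (reducible-span red) λ (s<r , s≼r) →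
  Span-weaken (map₁ (λ t≼s → ≼-trans t≼s s≼r)) (positive-span _ (rec s<r) (transfer s≼r h))

infix 4 _≤∞_

_≤∞_ : ℤ → Maybe ℤ → Set
b ≤∞ nothing = ⊤
b ≤∞ just m = b ℤ.≤ m

≤∞-mIdx-∷ : ∀ b x k → b ≤∞ mIdx (x ∷ k) ⇔ (b ℤ.≤ defect (x ∷ k) × b ≤∞ mIdx k)
≤∞-mIdx-∷ b x k with mIdx k
... | nothing = mk⇔ (_, tt) proj₁
... | just m  =
  mk⇔ (λ h → ℤP.≤-trans h (ℤP.i⊓j≤i _ m) , ℤP.≤-trans h (ℤP.i⊓j≤j _ m)) (uncurry ℤP.⊓-glb)

≤ᵐ-reverseAcc : ∀ b ys k → b ≤ᵐ reverseAcc ys k ⇔ (b ≤∞ mIdx k × b ℤ.- defect k ≤ᵐ ys)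
≤ᵐ-reverseAcc b ys [] =
  mk⇔ (λ h → tt , subst (_≤ᵐ ys) (sym (ℤP.+-identityʳ b)) h)
      (subst (_≤ᵐ ys) (ℤP.+-identityʳ b) ∘ proj₂)
≤ᵐ-reverseAcc b ys (x ∷ k) = mk⇔ to from
  where
  module IH = Equivalence (≤ᵐ-reverseAcc b (x ∷ ys) k)
  module M = Equivalence (≤∞-mIdx-∷ b x k)
  module S = Equivalence (sub-≤⇔≤-+ {b} {defect k} {x ℤ.- + 1})
  regroup : ∀ b d e → b ℤ.- d ℤ.- e ≡ b ℤ.- (e ℤ.+ d)
  regroup = solve-∀ ℤ-ring
  total : b ℤ.- defect k ℤ.- (x ℤ.- + 1) ≡ b ℤ.- defect (x ∷ k)
  total = regroup b (defect k) (x ℤ.- + 1)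
  to : b ≤ᵐ reverseAcc (x ∷ ys) k → b ≤∞ mIdx (x ∷ k) × b ℤ.- defect (x ∷ k) ≤ᵐ ys
  to h with IH.to h
  ... | k-ok , hx , hys = M.from (S.to hx , k-ok) , subst (_≤ᵐ ys) total hys
  from : b ≤∞ mIdx (x ∷ k) × b ℤ.- defect (x ∷ k) ≤ᵐ ys → b ≤ᵐ reverseAcc (x ∷ ys) k
  from (xk-ok , hys) with M.to xk-ok
  ... | hb , k-ok = IH.from (k-ok , S.from hb , subst (_≤ᵐ ys) (sym total) hys)

≤ᵐ-reverse : ∀ b k → b ≤ᵐ reverse k ⇔ b ≤∞ mIdx k
≤ᵐ-reverse b k = mk⇔ (proj₁ ∘ to) (λ h → from (h , tt))
  where open Equivalence (≤ᵐ-reverseAcc b [] k)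

admissible⇔ : ∀ k → Admissible k ⇔ + 1 ≤ᵐ reverse k
admissible⇔ k = ⇔-sym (≤ᵐ-reverse (+ 1) k) ⇔-∘ admissible⇔≤∞
  where
  admissible⇔≤∞ : Admissible k ⇔ + 1 ≤∞ mIdx k
  admissible⇔≤∞ with mIdx k
  ... | nothing = ⇔-id _
  ... | just m  = mk⇔ ℤP.i<j⇒suc[i]≤j ℤP.suc[i]≤j⇒i<j

regularizable⇔ : ∀ k → Regularizable k ⇔ + 0 ≤ᵐ reverse k
regularizable⇔ k = ⇔-sym (≤ᵐ-reverse (+ 0) k) ⇔-∘ regularizable⇔≤∞
  where
  regularizable⇔≤∞ : Regularizable k ⇔ + 0 ≤∞ mIdx k
  regularizable⇔≤∞ with mIdx k
  ... | nothing = ⇔-id _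
  ... | just m  = ⇔-id _

All-reverse : ∀ {A : Set} {R : A → Set} {xs} → All R xs → All R (reverse xs)
All-reverse rs = All.tabulate (λ x∈ → All.lookup rs (AnyP.reverse⁻ x∈))

Li-span : ∀ {b} k → + 0 ℤ.≤ b → b ≤ᵐ reverse k →
  Span Li (λ s → b ≤ᵐ reverse s × Positive s) (Li k)
Li-span {b} k 0≤b b≤k =
  Span-bind (positive-span (reverse k) (<-wellFounded _) (≤ᵐ-antitone (reverse k) 0≤b b≤k))
    λ {s} (s≼k , pos) →
      Span-cong (λ N → cong (λ t → coeffRev t N) (ListP.reverse-involutive s))
        (Span-single (subst (b ≤ᵐ_) (sym (ListP.reverse-involutive s)) (transfer s≼k b≤k) , All-reverse pos))

admissible-span : ∀ k → Admissible k → Span Li AdmissiblePositive (Li k)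
admissible-span k adm =
  Span-weaken (λ {s} → map₁ (Equivalence.from (admissible⇔ s)))
    (Li-span k (+≤+ ℕ.z≤n) (Equivalence.to (admissible⇔ k) adm))

regularizable-span : ∀ k → Regularizable k → Span Li Positive (Li k)
regularizable-span k reg = Span-weaken proj₂ (Li-span k ℤP.≤-refl (Equivalence.to (regularizable⇔ k) reg))

positive⇒regularizable : ∀ k → Positive k → Regularizable k
positive⇒regularizable k pos =
  Equivalence.from (regularizable⇔ k) (positive⇒≤ᵐ (reverse k) ℤP.≤-refl (All-reverse pos))

linComb≡combine : ∀ l N → linComb l N ≡ combine (λ k → Li k N) l
linComb≡combine [] N = refl
linComb≡combine ((c , k) ∷ l) N = cong (λ e → c * Li k N + e) (linComb≡combine l N)

InSpanLi-refine : (∀ {k} → P k → Span Li Q (Li k)) → InSpanLi P f → InSpanLi Q f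
InSpanLi-refine h (l , ps , e) with Span-bind (l , ps , λ N → trans (e N) (linComb≡combine l N)) h
... | l′ , qs , e′ = l′ , qs , λ N → trans (e′ N) (sym (linComb≡combine l′ N))

proposition3p5 :
    ((f : Series) → InSpanLi AdmissiblePositive f ⇔ InSpanLi Admissible f)
    × ((f : Series) → InSpanLi Positive f ⇔ InSpanLi Regularizable f)
proposition3p5 =
  (λ f → mk⇔ (InSpanLi-refine λ {k} → Span-single {r = k} ∘ proj₁)
             (InSpanLi-refine λ {k} → admissible-span k)) ,
  (λ f → mk⇔ (InSpanLi-refine λ {k} → Span-single {r = k} ∘ positive⇒regularizable k)
             (InSpanLi-refine λ {k} → regularizable-span k))
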